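{- (First Isomorphism Theorem for schemes.) Let $S$ and $T$ be association schemes on finite sets $X$ and $Y$, and let $\phi$ be an admissible morphism from $S$ to $T$. Let $K=\ker\phi$. Then: (1) $K$ is a normal closed subset of $S$. (2) $\phi(S)=\{\phi(s):s\in S\}$ is a closed subset of $T$ and $\phi(X)=\{\phi(x):x\in X\}$ is a geometric coset of $\phi(S)$; hence $\operatorname{im}\phi:=\{\phi(s)\cap(\phi(X)\times\phi(X)):s\in S\}$ is the subscheme of $T$ on $\phi(X)$ determined by the closed subset $\phi(S)$ and its geometric coset $\phi(X)$. (3) The assignment $\bar\phi(xK)=\phi(x)$ for $x\in X$ and $\bar\phi(s^K)=\phi(s)\cap(\phi(X)\times\phi(X))$ for $s\in S$ gives a well-defined isomorphism of schemes $\bar\phi$ from $S/\!/K$ (on $X/K$) to $\operatorname{im}\phi$ (on $\phi(X)$), and $\phi=\iota\circ\bar\phi\circ\pi_K$, where $\pi_K:S\to S/\!/K$ is given by $\pi_K(x)=xK$, $\pi_K(s)=s^K$, and $\iota:\operatorname{im}\phi\to T$ is the inclusion morphism given by $\iota(y)=y$ for $y\in\phi(X)$ and $\iota(t\cap(\phi(X)\times\phi(X)))=t$ for $t\in\phi(S)$.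
   Context: An association scheme on a finite set $X$ is a partition $S$ of $X\times X$ into nonempty subsets such that $1_X=\{(x,x):x\in X\}\in S$; for each $s\in S$, $s^*=\{(x,y):(y,x)\in s\}\in S$; and for all $p,q,r\in S$ there is an integer $a_{pq}^r\ge 0$ with $|\{y:(x,y)\in p,(y,z)\in q\}|=a_{pq}^r$ whenever $(x,z)\in r$. For $P,Q\subseteq S$ the complex product is $PQ=\{r\in S:a_{pq}^r>0\text{ for some }p\in P,q\in Q\}$ (write $pQ$ for $\{p\}Q$, etc.). A nonempty $T\subseteq S$ is closed if $TT=T$; a closed subset $T$ is normal if $pT=Tp$ for all $p\in S$. For $x\in X$, $s\in S$, let $xs=\{y:(x,y)\in s\}$, and for closed $T$ let $xT=\bigcup_{t\in T}xt$ (a geometric coset of $T$); $X/T$ is the set of geometric cosets. For closed $T$ and a geometric coset $W$ of $T$, the sets $t\cap(W\times W)$ ($t\in T$), when nonempty, form a scheme on $W$ (a subscheme). For closed $T$ and $s\in S$, $s^T=\{(xT,yT):(x',y')\in s\text{ for some }x'\in xT,y'\in yT\}$, and $S/\!/T=\{s^T:s\in S\}$ is a scheme on $X/T$ (the quotient scheme). A morphism from a scheme $S$ on $X$ to a scheme $T$ on $Y$ is a function $\phi:X\cup S\to Y\cup T$ with $\phi(X)\subseteq Y$, $\phi(S)\subseteq T$, and $(\phi(x_1),\phi(x_2))\in\phi(s)$ whenever $(x_1,x_2)\in s$. It is admissible if whenever $x\in X$, $y\in Y$, $s\in S$ and $(\phi(x),y)\in\phi(s)$, there is $x'\in X$ with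 $\phi(x')=y$ and $(x,x')\in s$. Its kernel is $\ker\phi=\{s\in S:\phi(s)=1_Y\}$. An isomorphism is a bijective morphism. -}

module Defs where

open import Data.Nat using (ℕ; _<_)
open import Data.Fin using (Fin; _≟_)
open import Data.List using (length; filter; allFin)
open import Data.Product using (Σ; ∃; ∃-syntax; _×_; _,_)
open import Relation.Nullary.Decidable using (_×-dec_)
open import Relation.Binary.PropositionalEquality using (_≡_)

_⇔_ : Set → Set → Set
A ⇔ B = (A → B) × (B → A)

_≐_ : {A : Set} → (A → Set) → (A → Set) → Set
P ≐ Q = ∀ a → P a ⇔ Q a

-- An association scheme on the finite set X = Fin n with relation set
-- S = Fin d.  `rel x y` is the (unique) relation s ∈ S containing (x,y);
-- the relation s, as a subset of X × X, is {(x,y) : rel x y ≡ s}.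
record Scheme (n d : ℕ) : Set where
  field
    rel      : Fin n → Fin n → Fin d
    nonempty : ∀ (s : Fin d) → ∃[ x ] ∃[ y ] (rel x y ≡ s)
    one      : Fin d
    one-spec : ∀ x y → (rel x y ≡ one) ⇔ (x ≡ y)
    _*       : Fin d → Fin d
    *-spec   : ∀ s x y → (rel y x ≡ s) ⇔ (rel x y ≡ (s *))
    a        : Fin d → Fin d → Fin d → ℕ
    a-spec   : ∀ p q r x z → rel x z ≡ r →
               length (filter (λ y → (rel x y ≟ p) ×-dec (rel y z ≟ q)) (allFin n))
                 ≡ a p q r

open Scheme public

module _ {n d : ℕ} (S : Scheme n d) where

  cplx : (Fin d → Set) → (Fin d → Set) → (Fin d → Set)
  cplx P Q r = ∃[ p ] ∃[ q ] (P p × Q q × 0 < a S p q r)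

  single : Fin d → (Fin d → Set)
  single p s = s ≡ p

  Closed : (Fin d → Set) → Set
  Closed T = (∃[ t ] T t) × (cplx T T ≐ T)

  Normal : (Fin d → Set) → Set
  Normal T = Closed T × (∀ p → cplx (single p) T ≐ cplx T (single p))

  coset : (Fin d → Set) → Fin n → (Fin n → Set)
  coset T x y = ∃[ t ] (T t × rel S x y ≡ t)

  quotRel : (Fin d → Set) → Fin d → Fin n → Fin n → Set
  quotRel T s x y = ∃[ x' ] ∃[ y' ] (coset T x x' × coset T y y' × rel S x' y' ≡ s)

record Morphism {n d m e : ℕ} (S : Scheme n d) (T : Scheme m e) : Set where
  field
    φX  : Fin n → Fin m
    φS  : Fin d → Fin e
    hom : ∀ x₁ x₂ → rel T (φX x₁) (φX x₂) ≡ φS (rel S x₁ x₂)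

open Morphism public

module _ {n d m e : ℕ} {S : Scheme n d} {T : Scheme m e} (φ : Morphism S T) where

  Admissible : Set
  Admissible = ∀ x y s → rel T (φX φ x) y ≡ φS φ s →
               ∃[ x' ] (φX φ x' ≡ y × rel S x x' ≡ s)

  ker : Fin d → Set
  ker s = φS φ s ≡ one T

  imS : Fin e → Set
  imS t = ∃[ s ] (φS φ s ≡ t)

  imX : Fin m → Set
  imX y = ∃[ x ] (φX φ x ≡ y)

  imRel : Fin d → Fin m → Fin m → Set
  imRel s y₁ y₂ = rel T y₁ y₂ ≡ φS φ s × imX y₁ × imX y₂

module Submission where

-- Everything is driven by two facts about an admissible morphism φ : S → T
-- with kernel K.  First, K detects fibres: (x,z) lies in a relation of K iff
-- φ(x) = φ(z), so the geometric coset xK is exactly the fibre of φ over φ(x).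
-- Second, admissibility lets us lift edges of T out of φ(X): an edge from
-- φ(x) coloured φ(s) lifts to an s-edge from x, and in particular an edge
-- leaving one point of a fibre can be moved to any other point of that fibre.

open import Defs
open import Data.Nat using (ℕ; _<_)
open import Data.Fin using (Fin)
open import Data.List using (List; _∷_; length; allFin)
open import Data.List.Properties using (filter-some)
open import Data.List.Relation.Unary.Any using (here)
open import Data.List.Membership.Propositional using (_∈_; lose)
open import Data.List.Membership.Propositional.Properties using (∈-allFin; ∈-filter⁻)
open import Data.Product using (∃-syntax; _×_; _,_; proj₁; proj₂)
open import Relation.Binary.PropositionalEquality
  using (_≡_; refl; sym; trans; cong; cong₂; subst; module ≡-Reasoning)

element-of-nonempty : ∀ {A : Set} {xs : List A} → 0 < length xs → ∃[ x ] (x ∈ xs)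
element-of-nonempty {xs = x ∷ _} _ = x , here refl

module SchemeFacts {n d : ℕ} (S : Scheme n d) where

  path⇒a-pos : ∀ {p q r x y z} → rel S x z ≡ r → rel S x y ≡ p → rel S y z ≡ q →
               0 < a S p q r
  path⇒a-pos {p} {q} {r} {x} {y} {z} xz xy yz =
    subst (0 <_) (a-spec S p q r x z xz)
      (filter-some _ (lose (∈-allFin y) (xy , yz)))

  a-pos⇒path : ∀ {p q r x z} → 0 < a S p q r → rel S x z ≡ r →
               ∃[ y ] (rel S x y ≡ p × rel S y z ≡ q)
  a-pos⇒path {p} {q} {r} {x} {z} pos xz
    with element-of-nonempty (subst (0 <_) (sym (a-spec S p q r x z xz)) pos)
  ... | y , y∈ = y , proj₂ (∈-filter⁻ _ {xs = allFin n} y∈)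

  rel-refl : ∀ x → rel S x x ≡ one S
  rel-refl x = proj₂ (one-spec S x x) refl

  rel-transpose : ∀ {x y x' y'} → rel S x y ≡ rel S x' y' → rel S y x ≡ rel S y' x'
  rel-transpose {x} {y} {x'} {y'} e = sym
    (proj₂ (*-spec S (rel S y x) x' y')
      (trans (sym e) (proj₁ (*-spec S (rel S y x) x y) refl)))

  a-pos-one : ∀ r → 0 < a S r (one S) r
  a-pos-one r with nonempty S r
  ... | x , z , xz = path⇒a-pos xz xz (rel-refl z)

  -- Every relation leaves every point (positive valency), via 1 ∈ r r*.
  out-edge : ∀ r u → ∃[ w ] (rel S u w ≡ r)
  out-edge r u with nonempty S r
  ... | u₀ , w₀ , e with a-pos⇒path {r} {_* S r} (path⇒a-pos (rel-refl u₀) e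
                                       (proj₁ (*-spec S r w₀ u₀) e)) (rel-refl u)
  ... | w , uw , _ = w , uw

  closed-intro : (P : Fin d → Set) → P (one S) → (∀ r → cplx S P P r → P r) → Closed S P
  closed-intro P P1 PP⊆P = (one S , P1) , λ r → PP⊆P r , λ Pr → r , one S , Pr , P1 , a-pos-one r

module MorphismFacts {n d m e : ℕ} {S : Scheme n d} {T : Scheme m e} (φ : Morphism S T) where
  open SchemeFacts

  edge-image : ∀ {x y s} → rel S x y ≡ s → rel T (φX φ x) (φX φ y) ≡ φS φ s
  edge-image {x} {y} xy = trans (hom φ x y) (cong (φS φ) xy)

  φ-one : φS φ (one S) ≡ one T
  φ-one = trans (cong (φS φ) (sym (rel-refl S x))) (trans (sym (hom φ x x)) (rel-refl T (φX φ x)))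
    where x = proj₁ (nonempty S (one S))

  ker⇒same-image : ∀ {x z} → ker φ (rel S x z) → φX φ x ≡ φX φ z
  ker⇒same-image {x} {z} k = proj₁ (one-spec T _ _) (trans (hom φ x z) k)

  same-image⇒ker : ∀ {x z} → φX φ x ≡ φX φ z → ker φ (rel S x z)
  same-image⇒ker {x} {z} eq = trans (sym (hom φ x z)) (proj₂ (one-spec T _ _) eq)

  ker-coset⇔fibre : ∀ x z → coset S (ker φ) x z ⇔ (φX φ x ≡ φX φ z)
  ker-coset⇔fibre x z =
    (λ { (t , kt , xz) → ker⇒same-image (subst (ker φ) (sym xz) kt) }) ,
    (λ eq → rel S x z , same-image⇒ker eq , refl)

  quotRel⇒edge-image : ∀ s x y → quotRel S (ker φ) s x y → rel T (φX φ x) (φX φ y) ≡ φS φ s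
  quotRel⇒edge-image s x y (x' , y' , xx' , yy' , x'y') = begin
    rel T (φX φ x) (φX φ y)   ≡⟨ cong₂ (rel T) (proj₁ (ker-coset⇔fibre x x') xx')
                                           (proj₁ (ker-coset⇔fibre y y') yy') ⟩
    rel T (φX φ x') (φX φ y') ≡⟨ edge-image x'y' ⟩
    φS φ s                    ∎
    where open ≡-Reasoning

  same-image⇒same-imRel : ∀ {s s'} → φS φ s ≡ φS φ s' → ∀ y₁ y₂ → imRel φ s y₁ y₂ ⇔ imRel φ s' y₁ y₂
  same-image⇒same-imRel eq y₁ y₂ =
    (λ { (c , i , j) → trans c eq , i , j }) , (λ { (c , i , j) → trans c (sym eq) , i , j })

  imRel-nonempty : ∀ s → ∃[ y₁ ] ∃[ y₂ ] imRel φ s y₁ y₂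
  imRel-nonempty s with nonempty S s
  ... | x , y , xy = φX φ x , φX φ y , edge-image xy , (x , refl) , (y , refl)

  imRel⊆⇒same-image : ∀ s s' → (∀ y₁ y₂ → imRel φ s y₁ y₂ → imRel φ s' y₁ y₂) → φS φ s ≡ φS φ s'
  imRel⊆⇒same-image s s' ⊆ with imRel-nonempty s
  ... | y₁ , y₂ , c , i , j = trans (sym c) (proj₁ (⊆ y₁ y₂ (c , i , j)))

  -- The restrictions to φ(X) determine φ(s), so ι is well defined.
  same-imRel⇒same-image : ∀ s s' → (∀ y₁ y₂ → imRel φ s y₁ y₂ ⇔ imRel φ s' y₁ y₂) → φS φ s ≡ φS φ s'
  same-imRel⇒same-image s s' same = imRel⊆⇒same-image s s' (λ y₁ y₂ → proj₁ (same y₁ y₂))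

  -- Cosets of K are fibres of φ, so φ̄ is well defined and injective on X/K.
  φ̄-points-well-defined : ∀ x x' → coset S (ker φ) x ≐ coset S (ker φ) x' → φX φ x ≡ φX φ x'
  φ̄-points-well-defined x x' same =
    proj₁ (ker-coset⇔fibre x x') (proj₂ (same x') (proj₂ (ker-coset⇔fibre x' x') refl))

  φ̄-points-injective : ∀ x x' → φX φ x ≡ φX φ x' → coset S (ker φ) x ≐ coset S (ker φ) x'
  φ̄-points-injective x x' eq z =
    (λ c → proj₂ (ker-coset⇔fibre x' z) (trans (sym eq) (proj₁ (ker-coset⇔fibre x z) c))) ,
    (λ c → proj₂ (ker-coset⇔fibre x z) (trans eq (proj₁ (ker-coset⇔fibre x' z) c)))

module AdmissibleFacts {n d m e : ℕ} {S : Scheme n d} {T : Scheme m e}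
                       (φ : Morphism S T) (adm : Admissible φ) where
  open SchemeFacts
  open MorphismFacts φ

  image-step : ∀ x w → imS φ (rel T (φX φ x) w) → imX φ w
  image-step x w (s , eq) with adm x w s (sym eq)
  ... | x' , φx'≡w , _ = x' , φx'≡w

  fibre-shift : ∀ {x y} → φX φ x ≡ φX φ y → ∀ z →
                ∃[ z' ] (φX φ z' ≡ φX φ z × rel S x z' ≡ rel S y z)
  fibre-shift {x} {y} eq z = adm x (φX φ z) (rel S y z)
    (trans (cong (λ u → rel T u (φX φ z)) eq) (hom φ y z))

  edge-image⇒quotRel : ∀ s x y → rel T (φX φ x) (φX φ y) ≡ φS φ s → quotRel S (ker φ) s x y
  edge-image⇒quotRel s x y c with adm x (φX φ y) s c
  ... | y' , φy'≡φy , xy' =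
    x , y' , proj₂ (ker-coset⇔fibre x x) refl , proj₂ (ker-coset⇔fibre y y') (sym φy'≡φy) , xy'

  same-image⇒same-quotRel : ∀ {s s'} → φS φ s ≡ φS φ s' → ∀ x y →
                            quotRel S (ker φ) s x y ⇔ quotRel S (ker φ) s' x y
  same-image⇒same-quotRel {s} {s'} eq x y =
    (λ q → edge-image⇒quotRel s' x y (trans (quotRel⇒edge-image s x y q) eq)) ,
    (λ q → edge-image⇒quotRel s x y (trans (quotRel⇒edge-image s' x y q) (sym eq)))

  -- (1) K is normal closed: a K-K path stays within one fibre, and pK = Kp
  -- because edges can be shifted along fibres.
  ker-normal : Normal S (ker φ)
  ker-normal = closed-intro S (ker φ) φ-one ker-closed , λ p r → p·K⊆K·p p r , K·p⊆p·K p r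
    where
    ker-closed : ∀ r → cplx S (ker φ) (ker φ) r → ker φ r
    ker-closed r (p , q , kp , kq , pos) with nonempty S r
    ... | x , z , xz with a-pos⇒path S pos xz
    ... | y , xy , yz = subst (ker φ) xz (same-image⇒ker
          (trans (ker⇒same-image (subst (ker φ) (sym xy) kp))
                 (ker⇒same-image (subst (ker φ) (sym yz) kq))))
    -- x -p-> y -K-> z: move the edge y -> x so that it starts at z.
    p·K⊆K·p : ∀ p r → cplx S (single S p) (ker φ) r → cplx S (ker φ) (single S p) r
    p·K⊆K·p p r (.p , q , refl , kq , pos) with nonempty S r
    ... | x , z , xz with a-pos⇒path S pos xz
    ... | y , xy , yz with fibre-shift (sym (ker⇒same-image (subst (ker φ) (sym yz) kq))) x
    ... | y' , φy'≡φx , zy'≡yx =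
      rel S x y' , p , same-image⇒ker (sym φy'≡φx) , refl ,
      path⇒a-pos S xz refl (trans (rel-transpose S zy'≡yx) xy)
    -- x -K-> y -p-> z: move the p-edge y -> z so that it starts at x.
    K·p⊆p·K : ∀ p r → cplx S (ker φ) (single S p) r → cplx S (single S p) (ker φ) r
    K·p⊆p·K p r (q , .p , kq , refl , pos) with nonempty S r
    ... | x , z , xz with a-pos⇒path S pos xz
    ... | y , xy , yz with fibre-shift (ker⇒same-image (subst (ker φ) (sym xy) kq)) z
    ... | y' , φy'≡φz , xy'≡yz =
      p , rel S y' z , refl , same-image⇒ker φy'≡φz , path⇒a-pos S xz (trans xy'≡yz yz) refl

  -- A base point of X; φ(X) is the geometric coset of φ(S) through its image.
  base : Fin n
  base = proj₁ (nonempty S (one S))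

  image-closed : Closed T (imS φ)
  image-closed = closed-intro T (imS φ) (one S , φ-one) product⊆image
    where
    -- Walk a p-q path from φ(base): both steps stay inside φ(X).
    product⊆image : ∀ r → cplx T (imS φ) (imS φ) r → imS φ r
    product⊆image r (p , q , Sp , Sq , pos) with out-edge T r (φX φ base)
    ... | w , bw with a-pos⇒path T pos bw
    ... | v , bv , vw with image-step base v (subst (imS φ) (sym bv) Sp)
    ... | x₁ , refl with image-step x₁ w (subst (imS φ) (sym vw) Sq)
    ... | x₂ , refl = rel S base x₂ , trans (sym (hom φ base x₂)) bw

  image-coset : imX φ ≐ coset T (imS φ) (φX φ base)
  image-coset w = (λ { (x , refl) → rel T (φX φ base) w , (rel S base x , sym (hom φ base x)) , refl })
                , (λ { (t , St , bw) → image-step base w (subst (imS φ) (sym bw) St) })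

  -- φ̄ is well defined on S//K: evaluate s^K = s'^K on the K-classes of an s-edge.
  φ̄-relations-well-defined : ∀ s s' → (∀ x y → quotRel S (ker φ) s x y ⇔ quotRel S (ker φ) s' x y) →
                             ∀ y₁ y₂ → imRel φ s y₁ y₂ ⇔ imRel φ s' y₁ y₂
  φ̄-relations-well-defined s s' same with nonempty S s
  ... | x , y , xy = same-image⇒same-imRel (trans (sym (edge-image xy))
        (quotRel⇒edge-image s' x y (proj₁ (same x y) (edge-image⇒quotRel s x y (edge-image xy)))))

  φ̄-relations-injective : ∀ s s' → (∀ y₁ y₂ → imRel φ s y₁ y₂ ⇔ imRel φ s' y₁ y₂) →
                          ∀ x y → quotRel S (ker φ) s x y ⇔ quotRel S (ker φ) s' x y
  φ̄-relations-injective s s' same = same-image⇒same-quotRel (same-imRel⇒same-image s s' same)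

theorem4p5 : {n d m e : ℕ} (S : Scheme n d) (T : Scheme m e) (φ : Morphism S T) →
    Admissible φ →
    Normal S (ker φ)
    × (Closed T (imS φ) × (∃[ y ] (imX φ ≐ coset T (imS φ) y)))
    × ((∀ s → ∃[ y₁ ] ∃[ y₂ ] imRel φ s y₁ y₂)
    × (∀ t → imS φ t → ∃[ y₁ ] ∃[ y₂ ] (rel T y₁ y₂ ≡ t × imX φ y₁ × imX φ y₂) →
    ∃[ s ] (∀ y₁ y₂ → imRel φ s y₁ y₂ ⇔ (rel T y₁ y₂ ≡ t × imX φ y₁ × imX φ y₂))))
    × ((∀ x x' → coset S (ker φ) x ≐ coset S (ker φ) x' → φX φ x ≡ φX φ x')
    × (∀ s s' → (∀ x y → quotRel S (ker φ) s x y ⇔ quotRel S (ker φ) s' x y) →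
    ∀ y₁ y₂ → imRel φ s y₁ y₂ ⇔ imRel φ s' y₁ y₂))
    × (∀ s x y → quotRel S (ker φ) s x y → imRel φ s (φX φ x) (φX φ y))
    × ((∀ x x' → φX φ x ≡ φX φ x' → coset S (ker φ) x ≐ coset S (ker φ) x')
    × (∀ y → imX φ y → ∃[ x ] (φX φ x ≡ y)))
    × (∀ s s' → (∀ y₁ y₂ → imRel φ s y₁ y₂ ⇔ imRel φ s' y₁ y₂) →
    ∀ x y → quotRel S (ker φ) s x y ⇔ quotRel S (ker φ) s' x y)
    × ((∀ s s' → (∀ y₁ y₂ → imRel φ s y₁ y₂ ⇔ imRel φ s' y₁ y₂) → φS φ s ≡ φS φ s')
    × (∀ s y₁ y₂ → imRel φ s y₁ y₂ → rel T y₁ y₂ ≡ φS φ s))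
theorem4p5 S T φ adm =
  ker-normal ,
  (image-closed , (φX φ base , image-coset)) ,
  (imRel-nonempty , (λ { t (s , refl) _ → s , λ _ _ → (λ i → i) , (λ i → i) })) ,
  (φ̄-points-well-defined , φ̄-relations-well-defined) ,
  (λ s x y q → quotRel⇒edge-image s x y q , (x , refl) , (y , refl)) ,
  (φ̄-points-injective , (λ y i → i)) ,
  φ̄-relations-injective ,
  (same-imRel⇒same-image , (λ s y₁ y₂ i → proj₁ i))
  where
  open MorphismFacts φ
  open AdmissibleFacts φ adm
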